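{- For every positive integer $n$, the integer $$a_n=\sum_{k=1}^{n}(-1)^{k-1}(k-1)!\,c(n,k)$$ equals the number of increasing trees on the vertex labels $1,\dots,n$ which, viewed as game trees, are games in which the second player has a winning strategy. In particular, $a_n\ge 0$ for all $n\ge 1$.
   Context: $c(n,k)$ denotes the (unsigned) Stirling number of the first kind: the number of permutations of $\{1,\dots,n\}$ with exactly $k$ cycles. An increasing tree on labels $1,\dots,n$ is a rooted tree whose $n$ vertices are labelled bijectively by $1,\dots,n$, with root labelled $1$, such that every vertex has a larger label than its parent. A rooted tree $T$ is viewed as the game tree of a two-player game: a token starts at the root; the players alternate moves, the first player moving first; a move consists of moving the token from its current vertex to one of its children; a player with no available move (token at a leaf) loses. "The second player has a winning strategy" is meant in the usual sense for this finite game. -}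

module Defs where

open import Data.Nat using (ℕ; zero; suc; _≤_; _≤?_; _<_)
open import Data.Nat using (_!)
open import Data.Fin using (Fin; toℕ; _≟_) renaming (zero to fzero; suc to fsuc)
open import Data.Vec using (Vec; []; _∷_; lookup; toList)
open import Data.List using (List; []; _∷_; map; concatMap; length; filter; upTo; allFin; foldr)
open import Data.List.Relation.Unary.All using (All; all?)
open import Data.List.Relation.Unary.Unique.Propositional using (Unique)
open import Data.List.Membership.Propositional using (_∈_)
open import Data.Integer using (ℤ; +_; -_; _*_; _+_) renaming (_^_ to _^ℤ_)
open import Data.Product using (Σ; _×_; _,_)
open import Function.Bundles using (_⇔_)
open import Relation.Binary.PropositionalEquality using (_≡_)
open import Relation.Nullary using (Dec; yes; no)
open import Relation.Nullary.Decidable using (_×-dec_)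
import Data.List.Relation.Unary.Unique.DecPropositional as UDec

allVecs : (n k : ℕ) → List (Vec (Fin k) n)
allVecs zero    k = [] ∷ []
allVecs (suc n) k = concatMap (λ x → map (x ∷_) (allVecs n k)) (allFin k)

-- Permutations of {1,…,n} (encoded on Fin n, label i+1 ↔ i) and cycles

-- σ : Vec (Fin n) n encodes the map i ↦ lookup σ i; it is a permutation
-- iff its entries are pairwise distinct (injective self-map of a finite set).
IsPerm : ∀ {n} → Vec (Fin n) n → Set
IsPerm σ = Unique (toList σ)

isPerm? : ∀ {n} (σ : Vec (Fin n) n) → Dec (IsPerm σ)
isPerm? σ = UDec.unique? _≟_ (toList σ)

iter : ∀ {n} → Vec (Fin n) n → ℕ → Fin n → Fin n
iter σ zero    i = i
iter σ (suc j) i = lookup σ (iter σ j i)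

-- i is the least element of its cycle (orbits have size ≤ n, so iterates
-- σ^j i for j < n exhaust the cycle of i)
CycleMin : ∀ {n} → Vec (Fin n) n → Fin n → Set
CycleMin {n} σ i = All (λ j → toℕ i ≤ toℕ (iter σ j i)) (upTo n)

cycleMin? : ∀ {n} (σ : Vec (Fin n) n) (i : Fin n) → Dec (CycleMin σ i)
cycleMin? {n} σ i = all? (λ j → toℕ i ≤? toℕ (iter σ j i)) (upTo n)

-- number of cycles = number of cycles' least elements
cycles : ∀ {n} → Vec (Fin n) n → ℕ
cycles {n} σ = length (filter (cycleMin? σ) (allFin n))

stirling1 : ℕ → ℕ → ℕ
stirling1 n k =
  length (filter (λ σ → isPerm? σ ×-dec (cycles σ Data.Nat.≟ k)) (allVecs n n))

sumℤ : List ℤ → ℤ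
sumℤ = foldr _+_ (+ 0)

a : ℕ → ℤ
a n = sumℤ (map (λ j → ((- + 1) ^ℤ j) * (+ (j !)) * (+ stirling1 n (suc j))) (upTo n))
  -- j = k - 1 ranges over 0 … n-1

-- Increasing trees on labels 1,…,m+1 (vertices Fin (suc m), vertex v has
-- label toℕ v + 1; root = fzero has label 1).
-- A rooted labelled tree with root fzero is given by its parent map on
-- the non-root vertices fsuc i (i : Fin m):  p : Vec (Fin (suc m)) m,
-- parent (fsuc i) = lookup p i.  It is increasing iff every parent has a
-- smaller label; that condition also guarantees the parent map is acyclic,
-- i.e. really defines a rooted tree.  Distinct increasing trees correspond
-- to distinct parent maps.

ParentMap : ℕ → Set
ParentMap m = Vec (Fin (suc m)) m

IsIncreasing : ∀ {m} → ParentMap m → Set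
IsIncreasing {m} p = (i : Fin m) → toℕ (lookup p i) < toℕ (fsuc {m} i)

-- Game on the tree: the player to move at v moves the token to a child.
mutual
  data Win {m} (p : ParentMap m) (v : Fin (suc m)) : Set where
    win : (i : Fin m) → lookup p i ≡ v → Lose p (fsuc i) → Win p v

  data Lose {m} (p : ParentMap m) (v : Fin (suc m)) : Set where
    lose : ((i : Fin m) → lookup p i ≡ v → Win p (fsuc i)) → Lose p v

-- the second player has a winning strategy: the first player (to move at
-- the root) loses
SecondPlayerWins : ∀ {m} → ParentMap m → Set
SecondPlayerWins p = Lose p fzero

HasCount : ∀ {A : Set} → (A → Set) → ℕ → Set
HasCount {A} P N =
  Σ (List A) λ L → Unique L × ((x : A) → (x ∈ L) ⇔ P x) × length L ≡ N

{-# OPTIONS --safe #-}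
module Submission where

open import Defs
open import Data.Nat using (ℕ; suc; z≤n)
open import Data.Integer using (ℤ; +_; _≤_; +≤+)
open import Data.List using (length)
open import Data.Product using (Σ; _×_; _,_)
open import Relation.Binary.PropositionalEquality using (_≡_; refl; sym; trans; subst)

-- Contracting the edge between the root and the vertex labelled 2, which is always a child of the
-- root, maps the increasing trees on m + 2 vertices onto those on m + 1. The fibre over a tree
-- consists of the ways of keeping each child of the root at the root or moving it below vertex 2,
-- and every other vertex keeps its subtree, hence its outcome. So for
--   F_m(x, y) = Σ_T x^(number of winning children of the root) y^(number of losing ones)
-- a child that wins (loses) contributes x + 1 (y + 1) summed over its two positions, while
-- vertex 2 contributes x if it receives a losing child and y otherwise:
--   F_{m+1}(x, y) = x F_m(x + 1, y + 1) + (y - x) F_m(x + 1, y).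
-- The root is lost for the first player iff all its children win, so F_m(1, 0) counts the trees
-- of the theorem. The same recursion is satisfied by
--   Σ_k (y - x)↓k [zᵏ] (x + z)(x + 1 + z)⋯(x + m - 1 + z),   where w↓k = w(w - 1)⋯(w - k + 1).
-- At (x, y) = (1, 0) this is Σ_k (-1)ᵏ k! c(m + 1, k + 1) = a_{m+1}, as [zᵏ] (1 + z)⋯(m + z) is
-- c(m + 1, k + 1) by the recurrence c(n + 1, k + 1) = n c(n, k + 1) + c(n, k); that recurrence comes
-- from inserting the new largest element as a fixed point or just before one of the old ones.

module Enumeration where

  open import Data.Bool using (Bool; true; false; if_then_else_)
  import Data.Bool.Properties as Bool
  open import Data.Fin using (Fin; zero; suc; fromℕ; inject₁)
  open import Data.Integer using (ℤ; +_; _+_; _*_)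
  import Data.Integer.Properties as ℤ
  open import Data.Integer.Tactic.RingSolver using (solve-∀)
  open import Data.List as List using (List; []; _∷_; _++_; map; concatMap; filter; length)
  import Data.List.Properties as List
  open import Data.List.Membership.Propositional using (_∈_; find)
  import Data.List.Membership.Propositional as Membership
  open import Data.List.Membership.Propositional.Properties
    using (∈-map⁺; ∈-map⁻; ∈-concatMap⁺; ∈-concatMap⁻)
  open import Data.List.Membership.Propositional.Properties.WithK using (unique∧set⇒bag)
  open import Data.List.Relation.Binary.BagAndSetEquality using (∼bag⇒↭)
  open import Data.List.Relation.Binary.Permutation.Propositional.Properties using (↭-length)
  import Data.List.Relation.Unary.All as All
  open import Data.List.Relation.Unary.AllPairs using ([]; _∷_)
  open import Data.List.Relation.Unary.Any using (here; there)
  open import Data.List.Relation.Unary.Unique.Propositional using (Unique)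
  import Data.List.Relation.Unary.Unique.Propositional.Properties as Unique
  open import Data.Nat as ℕ using (ℕ; zero; suc)
  open import Data.Product using (_×_; _,_)
  open import Data.Vec as Vec using (Vec; []; _∷_; lookup)
  open import Data.Vec.Properties using (∷-injectiveˡ; ∷-injectiveʳ)
  open import Function using (_∘_)
  open import Function.Bundles using (_⇔_; Equivalence)
  open import Level using (0ℓ)
  open import Relation.Binary.PropositionalEquality
  open import Relation.Nullary using (yes; no; does; contradiction)
  open import Relation.Unary using (Pred; Decidable)
  open ≡-Reasoning

  private
    variable
      A B C : Set
      n : ℕ

  sumOver : List A → (A → ℤ) → ℤ
  sumOver []       f = + 0
  sumOver (x ∷ xs) f = f x + sumOver xs f

  infix 6.5 sumOver
  syntax sumOver xs (λ x → e) = ∑[ x ∈ xs ] e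

  ∑-cong : ∀ (xs : List A) {f g : A → ℤ} → (∀ {x} → x ∈ xs → f x ≡ g x) →
           ∑[ x ∈ xs ] f x ≡ ∑[ x ∈ xs ] g x
  ∑-cong []       f≡g = refl
  ∑-cong (x ∷ xs) f≡g = cong₂ _+_ (f≡g (here refl)) (∑-cong xs (f≡g ∘ there))

  ∑-++ : ∀ (xs ys : List A) (f : A → ℤ) →
         ∑[ x ∈ xs ++ ys ] f x ≡ ∑[ x ∈ xs ] f x + ∑[ y ∈ ys ] f y
  ∑-++ []       ys f = sym (ℤ.+-identityˡ _)
  ∑-++ (x ∷ xs) ys f = trans (cong (_+_ (f x)) (∑-++ xs ys f)) (sym (ℤ.+-assoc (f x) _ _))

  ∑-map : ∀ (g : A → B) (xs : List A) (f : B → ℤ) → ∑[ y ∈ map g xs ] f y ≡ ∑[ x ∈ xs ] f (g x)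
  ∑-map g []       f = refl
  ∑-map g (x ∷ xs) f = cong (_+_ (f (g x))) (∑-map g xs f)

  ∑-concatMap : ∀ (g : A → List B) (xs : List A) (f : B → ℤ) →
                ∑[ y ∈ concatMap g xs ] f y ≡ ∑[ x ∈ xs ] ∑[ y ∈ g x ] f y
  ∑-concatMap g []       f = refl
  ∑-concatMap g (x ∷ xs) f =
    trans (∑-++ (g x) (concatMap g xs) f) (cong (_+_ (∑[ y ∈ g x ] f y)) (∑-concatMap g xs f))

  ∑-distrib-+ : ∀ (xs : List A) (f g : A → ℤ) →
                ∑[ x ∈ xs ] (f x + g x) ≡ ∑[ x ∈ xs ] f x + ∑[ x ∈ xs ] g x
  ∑-distrib-+ []       f g = refl
  ∑-distrib-+ (x ∷ xs) f g =
    trans (cong (_+_ (f x + g x)) (∑-distrib-+ xs f g)) (interchange (f x) (g x) _ _)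
    where
    interchange : ∀ a b c d → a + b + (c + d) ≡ a + c + (b + d)
    interchange = solve-∀

  ∑-distribˡ : ∀ c (xs : List A) (f : A → ℤ) → ∑[ x ∈ xs ] c * f x ≡ c * (∑[ x ∈ xs ] f x)
  ∑-distribˡ c []       f = sym (ℤ.*-zeroʳ c)
  ∑-distribˡ c (x ∷ xs) f =
    trans (cong (_+_ (c * f x)) (∑-distribˡ c xs f)) (sym (ℤ.*-distribˡ-+ c (f x) _))

  ∑-distribʳ : ∀ c (xs : List A) (f : A → ℤ) → ∑[ x ∈ xs ] f x * c ≡ (∑[ x ∈ xs ] f x) * c
  ∑-distribʳ c []       f = sym (ℤ.*-zeroˡ c)
  ∑-distribʳ c (x ∷ xs) f =
    trans (cong (_+_ (f x * c)) (∑-distribʳ c xs f)) (sym (ℤ.*-distribʳ-+ c (f x) _))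

  concatMap-unique : ∀ (f : A → List B) {xs : List A} → Unique xs → (∀ x → Unique (f x)) →
                     (∀ {x x′ y} → y ∈ f x → y ∈ f x′ → x ≡ x′) → Unique (concatMap f xs)
  concatMap-unique f {[]}     []           uf disjoint = []
  concatMap-unique f {x ∷ xs} (x∉xs ∷ uxs) uf disjoint =
    Unique.++⁺ (uf x) (concatMap-unique f uxs uf disjoint) λ (y∈fx , y∈rest) →
      let x′ , x′∈xs , y∈fx′ = find (∈-concatMap⁻ f y∈rest)
      in All.lookup x∉xs x′∈xs (disjoint y∈fx y∈fx′)

  consEach : List A → List (Vec A n) → List (Vec A (suc n))
  consEach l rs = concatMap (λ a → map (a ∷_) rs) l

  ∈-consEach⁺ : ∀ {a l} {r : Vec A n} {rs} → a ∈ l → r ∈ rs → (a ∷ r) ∈ consEach l rs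
  ∈-consEach⁺ a∈l r∈rs = ∈-concatMap⁺ _ (Membership.lose a∈l (∈-map⁺ _ r∈rs))

  ∈-consEach⁻ : ∀ {a} l {r : Vec A n} rs → (a ∷ r) ∈ consEach l rs → a ∈ l × r ∈ rs
  ∈-consEach⁻ l rs ar∈ with find (∈-concatMap⁻ (λ a → map (a ∷_) rs) {xs = l} ar∈)
  ... | a , a∈l , ar∈a∷rs with ∈-map⁻ (a ∷_) ar∈a∷rs
  ... | r , r∈rs , refl = a∈l , r∈rs

  consEach-unique : ∀ {l} {rs : List (Vec A n)} → Unique l → Unique rs → Unique (consEach l rs)
  consEach-unique ul urs = concatMap-unique _ ul (λ a → Unique.map⁺ ∷-injectiveʳ urs) same-head
    where
    same-head : ∀ {a a′ y} → y ∈ map (a ∷_) _ → y ∈ map (a′ ∷_) _ → a ≡ a′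
    same-head y∈ y∈′ with ∈-map⁻ _ y∈ | ∈-map⁻ _ y∈′
    ... | _ , _ , refl | _ , _ , eq = ∷-injectiveˡ eq

  ∑-consEach : ∀ (l : List A) (rs : List (Vec A n)) f →
               ∑[ v ∈ consEach l rs ] f v ≡ ∑[ a ∈ l ] ∑[ r ∈ rs ] f (a ∷ r)
  ∑-consEach l rs f =
    trans (∑-concatMap (λ a → map (a ∷_) rs) l f) (∑-cong l (λ {a} _ → ∑-map (a ∷_) rs f))

  choices : Vec (List A) n → List (Vec A n)
  choices []       = [] ∷ []
  choices (l ∷ ls) = consEach l (choices ls)

  choices-unique : ∀ (ls : Vec (List A) n) → (∀ i → Unique (lookup ls i)) → Unique (choices ls)
  choices-unique []       _  = All.[] ∷ []
  choices-unique (l ∷ ls) ul = consEach-unique (ul zero) (choices-unique ls (ul ∘ suc))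

  prodWith : (A → B → ℤ) → Vec A n → Vec B n → ℤ
  prodWith f []       []       = + 1
  prodWith f (a ∷ as) (b ∷ bs) = f a b * prodWith f as bs

  prodWith-cong : ∀ {f g : A → B → ℤ} → (∀ a b → f a b ≡ g a b) →
                  ∀ (as : Vec A n) bs → prodWith f as bs ≡ prodWith g as bs
  prodWith-cong f≡g []       []       = refl
  prodWith-cong f≡g (a ∷ as) (b ∷ bs) = cong₂ _*_ (f≡g a b) (prodWith-cong f≡g as bs)

  prodWith-map : ∀ (f : A → B → ℤ) (g : C → A) (cs : Vec C n) bs →
                 prodWith f (Vec.map g cs) bs ≡ prodWith (λ c → f (g c)) cs bs
  prodWith-map f g []       []       = refl
  prodWith-map f g (c ∷ cs) (b ∷ bs) = cong (f (g c) b *_) (prodWith-map f g cs bs)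

  prodWith-* : ∀ (f g : A → B → ℤ) (as : Vec A n) bs →
               prodWith f as bs * prodWith g as bs ≡ prodWith (λ a b → f a b * g a b) as bs
  prodWith-* f g []       []       = refl
  prodWith-* f g (a ∷ as) (b ∷ bs) =
    trans (interchange (f a b) _ (g a b) _) (cong (f a b * g a b *_) (prodWith-* f g as bs))
    where
    interchange : ∀ w x y z → w * x * (y * z) ≡ w * y * (x * z)
    interchange = solve-∀

  ∑-choices : ∀ (f : A → B → ℤ) (ls : Vec (List A) n) bs →
              ∑[ r ∈ choices ls ] prodWith f r bs ≡ prodWith (λ l b → ∑[ a ∈ l ] f a b) ls bs
  ∑-choices f []       []       = refl
  ∑-choices f (l ∷ ls) (b ∷ bs) = begin
    ∑[ r ∈ choices (l ∷ ls) ] prodWith f r (b ∷ bs)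
      ≡⟨ ∑-consEach l (choices ls) _ ⟩
    ∑[ a ∈ l ] ∑[ r ∈ choices ls ] f a b * prodWith f r bs
      ≡⟨ ∑-cong l (λ {a} _ → ∑-distribˡ (f a b) (choices ls) _) ⟩
    ∑[ a ∈ l ] f a b * (∑[ r ∈ choices ls ] prodWith f r bs)
      ≡⟨ ∑-distribʳ _ l (λ a → f a b) ⟩
    (∑[ a ∈ l ] f a b) * (∑[ r ∈ choices ls ] prodWith f r bs)
      ≡⟨ cong ((∑[ a ∈ l ] f a b) *_) (∑-choices f ls bs) ⟩
    (∑[ a ∈ l ] f a b) * prodWith (λ l b → ∑[ a ∈ l ] f a b) ls bs
      ∎

  length-filter-false : ∀ (b : A → Bool) xs →
    + length (filter (λ x → b x Bool.≟ false) xs) ≡ ∑[ x ∈ xs ] (if b x then + 0 else + 1)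
  length-filter-false b []       = refl
  length-filter-false b (x ∷ xs) with b x
  ... | true  = trans (length-filter-false b xs) (sym (ℤ.+-identityˡ _))
  ... | false = cong (_+_ (+ 1)) (length-filter-false b xs)

  module _ {P : Pred A 0ℓ} {Q : Pred B 0ℓ} (P? : Decidable P) (Q? : Decidable Q) where

    length-filter-tabulate-⇔ : ∀ {k} (f : Fin k → A) (g : Fin k → B) → (∀ i → P (f i) ⇔ Q (g i)) →
      length (filter P? (List.tabulate f)) ≡ length (filter Q? (List.tabulate g))
    length-filter-tabulate-⇔ {zero}  f g P⇔Q = refl
    length-filter-tabulate-⇔ {suc k} f g P⇔Q with P? (f zero) | Q? (g zero)
    ... | yes _  | yes _  = cong suc (length-filter-tabulate-⇔ (f ∘ suc) (g ∘ suc) (P⇔Q ∘ suc))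
    ... | no  _  | no  _  = length-filter-tabulate-⇔ (f ∘ suc) (g ∘ suc) (P⇔Q ∘ suc)
    ... | yes p  | no ¬q  = contradiction (Equivalence.to (P⇔Q zero) p) ¬q
    ... | no ¬p  | yes q  = contradiction (Equivalence.from (P⇔Q zero) q) ¬p

  length-filter-tabulate-last : ∀ {k} {P : Pred A 0ℓ} (P? : Decidable P) (f : Fin (suc k) → A) →
    length (filter P? (List.tabulate f))
      ≡ length (filter P? (List.tabulate (f ∘ inject₁))) ℕ.+ (if does (P? (f (fromℕ k))) then 1 else 0)
  length-filter-tabulate-last {k = zero}  P? f with does (P? (f zero))
  ... | true  = refl
  ... | false = refl
  length-filter-tabulate-last {k = suc k} P? f with does (P? (f zero))
  ... | true  = cong suc (length-filter-tabulate-last P? (f ∘ suc))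
  ... | false = length-filter-tabulate-last P? (f ∘ suc)

  length-cartesianProductWith : ∀ (f : A → B → C) xs ys →
    length (List.cartesianProductWith f xs ys) ≡ length xs ℕ.* length ys
  length-cartesianProductWith f []       ys = refl
  length-cartesianProductWith f (x ∷ xs) ys = trans (List.length-++ (map (f x) ys))
    (cong₂ ℕ._+_ (List.length-map (f x) ys) (length-cartesianProductWith f xs ys))

  same-members⇒length≡ : ∀ {xs ys : List A} → Unique xs → Unique ys →
                         (∀ {z} → z ∈ xs ⇔ z ∈ ys) → length xs ≡ length ys
  same-members⇒length≡ uxs uys same = ↭-length (∼bag⇒↭ (unique∧set⇒bag uxs uys same))

module StirlingRecurrence where

  open Enumeration using (consEach-unique; ∈-consEach⁺; same-members⇒length≡; length-cartesianProductWith;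
                          length-filter-tabulate-⇔; length-filter-tabulate-last)

  open import Data.Bool using (Bool; if_then_else_)
  open import Data.Empty using (⊥; ⊥-elim)
  open import Data.Fin as Fin using (Fin; zero; suc; toℕ; fromℕ; inject₁)
  import Data.Fin.Properties as Fin
  open import Data.Fin.Relation.Unary.Top using (view; ‵fromℕ; ‵inject₁)
  open import Data.List as List using (List; []; _∷_; _++_; length; filter; allFin; map)
  import Data.List.Properties as List
  open import Data.List.Membership.Propositional using (_∈_)
  open import Data.List.Membership.Propositional.Properties
    using (∈-map⁺; ∈-map⁻; ∈-++⁺ˡ; ∈-++⁺ʳ; ∈-++⁻; ∈-filter⁺; ∈-filter⁻; ∈-allFin;
           ∈-cartesianProductWith⁺; ∈-cartesianProductWith⁻)
  import Data.List.Relation.Unary.All as All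
  import Data.List.Relation.Unary.All.Properties as All
  open import Data.List.Relation.Unary.Any using (here)
  open import Data.List.Relation.Unary.AllPairs using ([]; _∷_)
  open import Data.List.Relation.Unary.Unique.Propositional using (Unique)
  import Data.List.Relation.Unary.Unique.Propositional.Properties as Unique
  open import Data.Nat as ℕ using (ℕ; zero; suc; _+_; _*_; _<_; z≤n)
  import Data.Nat.Properties as ℕ
  open import Data.Nat.DivMod using (_%_; _/_; m≡m%n+[m/n]*n; m%n<n)
  open import Data.Product using (∃-syntax; _×_; _,_; proj₁; proj₂)
  open import Data.Sum using (_⊎_; inj₁; inj₂)
  open import Data.Vec as Vec using (Vec; []; _∷_; lookup; toList; _∷ʳ_; tabulate)
  import Data.Vec.Properties as Vec
  open import Data.Vec.Membership.Propositional.Properties using (∈-lookup; ∈-toList⁺; ∈-toList⁻)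
  open import Data.Vec.Relation.Unary.Any.Properties using (lookup-index)
  open import Function using (_∘_; id)
  open import Function.Bundles using (_⇔_; mk⇔; Equivalence)
  open import Function.Construct.Composition using (_⇔-∘_)
  open import Function.Construct.Symmetry using (⇔-sym)
  open import Function.Definitions using (Injective)
  open import Relation.Binary.PropositionalEquality
  open import Relation.Nullary using (yes; no; does; contradiction)
  open import Relation.Nullary.Decidable using (_×-dec_; dec-true; dec-false; does-⇔)

  private
    variable
      A : Set
      n : ℕ

  IsInjection : Vec (Fin n) n → Set
  IsInjection σ = Injective _≡_ _≡_ (lookup σ)

  toList-unique⇒lookup-injective : ∀ (xs : Vec A n) → Unique (toList xs) → Injective _≡_ _≡_ (lookup xs)
  toList-unique⇒lookup-injective (x ∷ xs) (x∉ ∷ u) {zero}  {zero}  eq = refl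
  toList-unique⇒lookup-injective (x ∷ xs) (x∉ ∷ u) {zero}  {suc j} eq =
    ⊥-elim (All.lookup x∉ (∈-toList⁺ (∈-lookup j xs)) eq)
  toList-unique⇒lookup-injective (x ∷ xs) (x∉ ∷ u) {suc i} {zero}  eq =
    ⊥-elim (All.lookup x∉ (∈-toList⁺ (∈-lookup i xs)) (sym eq))
  toList-unique⇒lookup-injective (x ∷ xs) (x∉ ∷ u) {suc i} {suc j} eq =
    cong suc (toList-unique⇒lookup-injective xs u eq)

  lookup-injective⇒toList-unique : ∀ (xs : Vec A n) → Injective _≡_ _≡_ (lookup xs) → Unique (toList xs)
  lookup-injective⇒toList-unique []       inj = []
  lookup-injective⇒toList-unique (x ∷ xs) inj =
    All.tabulate (λ y∈ x≡y → Fin.0≢1+n (inj (trans x≡y (lookup-index (∈-toList⁻ y∈)))))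
    ∷ lookup-injective⇒toList-unique xs (Fin.suc-injective ∘ inj)

  isPerm⇔isInjection : ∀ (σ : Vec (Fin n) n) → IsPerm σ ⇔ IsInjection σ
  isPerm⇔isInjection σ = mk⇔ (toList-unique⇒lookup-injective σ) (lookup-injective⇒toList-unique σ)

  module _ (σ : Vec (Fin n) n) where

    iter-+ : ∀ a b i → iter σ (a + b) i ≡ iter σ a (iter σ b i)
    iter-+ zero    b i = refl
    iter-+ (suc a) b i = cong (lookup σ) (iter-+ a b i)

    iter-periodic : ∀ {d i} → iter σ d i ≡ i → ∀ q → iter σ (q * d) i ≡ i
    iter-periodic         σᵈi≡i zero    = refl
    iter-periodic {d} {i} σᵈi≡i (suc q) = begin
      iter σ (d + q * d) i       ≡⟨ iter-+ d (q * d) i ⟩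
      iter σ d (iter σ (q * d) i) ≡⟨ cong (iter σ d) (iter-periodic σᵈi≡i q) ⟩
      iter σ d i                  ≡⟨ σᵈi≡i ⟩
      i                           ∎
      where open ≡-Reasoning

    iter-mod : ∀ {d i} → iter σ (suc d) i ≡ i → ∀ j → iter σ j i ≡ iter σ (j % suc d) i
    iter-mod {d} {i} σ¹⁺ᵈi≡i j = begin
      iter σ j i
        ≡⟨ cong (λ k → iter σ k i) (m≡m%n+[m/n]*n j (suc d)) ⟩
      iter σ (j % suc d + j / suc d * suc d) i
        ≡⟨ iter-+ (j % suc d) _ i ⟩
      iter σ (j % suc d) (iter σ (j / suc d * suc d) i)
        ≡⟨ cong (iter σ (j % suc d)) (iter-periodic σ¹⁺ᵈi≡i (j / suc d)) ⟩
      iter σ (j % suc d) i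
        ∎
      where open ≡-Reasoning

    module _ (σ-inj : IsInjection σ) where

      iter-injective : ∀ a {u v} → iter σ a u ≡ iter σ a v → u ≡ v
      iter-injective zero    eq = eq
      iter-injective (suc a) eq = iter-injective a (σ-inj eq)

      -- Among the n + 1 points σ⁰ i, …, σⁿ i two coincide; injectivity cancels the smaller exponent.
      period : ∀ i → ∃[ d ] d < n × iter σ (suc d) i ≡ i
      period i with Fin.pigeonhole (ℕ.n<1+n n) (λ (a : Fin (suc n)) → iter σ (toℕ a) i)
      ... | a , b , a<b , σᵃi≡σᵇi with ℕ.m≤n⇒∃[o]m+o≡n a<b
      ... | d , 1+a+d≡b = d , d<n , iter-injective (toℕ a) (begin
        iter σ (toℕ a) (iter σ (suc d) i) ≡⟨ iter-+ (toℕ a) (suc d) i ⟨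
        iter σ (toℕ a + suc d) i          ≡⟨ cong (λ k → iter σ k i) a+1+d≡b ⟩
        iter σ (toℕ b) i                  ≡⟨ σᵃi≡σᵇi ⟨
        iter σ (toℕ a) i                  ∎)
        where
        open ≡-Reasoning
        a+1+d≡b : toℕ a + suc d ≡ toℕ b
        a+1+d≡b = trans (ℕ.+-suc (toℕ a) d) 1+a+d≡b
        d<n : d < n
        d<n = ℕ.≤-trans (ℕ.m≤n+m (suc d) (toℕ a))
                (ℕ.≤-trans (ℕ.≤-reflexive a+1+d≡b) (ℕ.≤-pred (Fin.toℕ<n b)))

      iter-below : ∀ i j → ∃[ j′ ] j′ < n × iter σ j i ≡ iter σ j′ i
      iter-below i j with period i
      ... | d , d<n , σ¹⁺ᵈi≡i = j % suc d , ℕ.<-≤-trans (m%n<n j (suc d)) d<n , iter-mod σ¹⁺ᵈi≡i j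

  OrbitMin : Vec (Fin n) n → Fin n → Set
  OrbitMin σ i = ∀ j → toℕ i ℕ.≤ toℕ (iter σ j i)

  cycleMin⇔orbitMin : ∀ (σ : Vec (Fin n) n) → IsInjection σ → ∀ i → CycleMin σ i ⇔ OrbitMin σ i
  cycleMin⇔orbitMin {n} σ σ-inj i = mk⇔ to (All.applyUpTo⁺₁ id n ∘ λ min {j} _ → min j)
    where
    to : CycleMin σ i → OrbitMin σ i
    to min j with iter-below σ σ-inj i j
    ... | j′ , j′<n , σʲi≡σʲ′i =
      subst (λ x → toℕ i ℕ.≤ toℕ x) (sym σʲi≡σʲ′i) (All.applyUpTo⁻ id n min j′<n)

  lookup-∷ʳ-inject₁ : ∀ {k} (xs : Vec A k) x j → lookup (xs ∷ʳ x) (inject₁ j) ≡ lookup xs j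
  lookup-∷ʳ-inject₁ (y ∷ xs) x zero    = refl
  lookup-∷ʳ-inject₁ (y ∷ xs) x (suc j) = lookup-∷ʳ-inject₁ xs x j

  lookup-∷ʳ-last : ∀ {k} (xs : Vec A k) x → lookup (xs ∷ʳ x) (fromℕ k) ≡ x
  lookup-∷ʳ-last []       x = refl
  lookup-∷ʳ-last (y ∷ xs) x = lookup-∷ʳ-last xs x

  lookup-extensionality : ∀ {k} (xs ys : Vec A k) → (∀ i → lookup xs i ≡ lookup ys i) → xs ≡ ys
  lookup-extensionality xs ys eq =
    trans (sym (Vec.tabulate∘lookup xs)) (trans (Vec.tabulate-cong eq) (Vec.tabulate∘lookup ys))

  redirect : Fin (suc n) → Fin n → Fin (suc n)
  redirect t y with inject₁ y Fin.≟ t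
  ... | yes _ = fromℕ _
  ... | no  _ = inject₁ y

  redirect-hit : ∀ {t : Fin (suc n)} {y} → inject₁ y ≡ t → redirect t y ≡ fromℕ n
  redirect-hit {t = t} {y} y↦t with inject₁ y Fin.≟ t
  ... | yes _   = refl
  ... | no  y↛t = contradiction y↦t y↛t

  redirect-miss : ∀ {t : Fin (suc n)} {y} → inject₁ y ≢ t → redirect t y ≡ inject₁ y
  redirect-miss {t = t} {y} y↛t with inject₁ y Fin.≟ t
  ... | yes y↦t = contradiction y↦t y↛t
  ... | no  _   = refl

  redirect-≢ : ∀ (t : Fin (suc n)) y → redirect t y ≢ t
  redirect-≢ t y with inject₁ y Fin.≟ t
  ... | yes y↦t = λ last≡t → Fin.fromℕ≢inject₁ (trans last≡t (sym y↦t))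
  ... | no  y↛t = y↛t

  redirect-injective : ∀ (t : Fin (suc n)) → Injective _≡_ _≡_ (redirect t)
  redirect-injective t {y} {y′} eq with inject₁ y Fin.≟ t | inject₁ y′ Fin.≟ t
  ... | yes y↦t | yes y′↦t = Fin.inject₁-injective (trans y↦t (sym y′↦t))
  ... | no  _   | no  _    = Fin.inject₁-injective eq
  ... | yes _   | no  _    = contradiction eq Fin.fromℕ≢inject₁
  ... | no  _   | yes _    = contradiction (sym eq) Fin.fromℕ≢inject₁

  -- The new maximal element n is placed just before t on its cycle; for t = n it becomes a fixed point.
  insertMax : Vec (Fin n) n → Fin (suc n) → Vec (Fin (suc n)) (suc n)
  insertMax σ t = Vec.map (redirect t) σ ∷ʳ t

  module _ (σ : Vec (Fin n) n) (t : Fin (suc n)) where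

    lookup-insertMax-inject₁ : ∀ j → lookup (insertMax σ t) (inject₁ j) ≡ redirect t (lookup σ j)
    lookup-insertMax-inject₁ j =
      trans (lookup-∷ʳ-inject₁ (Vec.map (redirect t) σ) t j) (Vec.lookup-map j (redirect t) σ)

    lookup-insertMax-last : lookup (insertMax σ t) (fromℕ n) ≡ t
    lookup-insertMax-last = lookup-∷ʳ-last (Vec.map (redirect t) σ) t

    insertMax-injective : IsInjection σ → IsInjection (insertMax σ t)
    insertMax-injective σ-inj {a} {b} eq with view a | view b
    ... | ‵inject₁ i | ‵inject₁ j = cong inject₁ (σ-inj (redirect-injective t
      (trans (sym (lookup-insertMax-inject₁ i)) (trans eq (lookup-insertMax-inject₁ j)))))
    ... | ‵inject₁ i | ‵fromℕ = contradiction
      (trans (sym (lookup-insertMax-inject₁ i)) (trans eq lookup-insertMax-last))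
      (redirect-≢ t (lookup σ i))
    ... | ‵fromℕ | ‵inject₁ j = contradiction
      (trans (sym (lookup-insertMax-inject₁ j)) (trans (sym eq) lookup-insertMax-last))
      (redirect-≢ t (lookup σ j))
    ... | ‵fromℕ | ‵fromℕ = refl

    insertMax-injective⁻ : IsInjection (insertMax σ t) → IsInjection σ
    insertMax-injective⁻ τ-inj {i} {j} eq = Fin.inject₁-injective (τ-inj (begin
      lookup (insertMax σ t) (inject₁ i) ≡⟨ lookup-insertMax-inject₁ i ⟩
      redirect t (lookup σ i)            ≡⟨ cong (redirect t) eq ⟩
      redirect t (lookup σ j)            ≡⟨ lookup-insertMax-inject₁ j ⟨
      lookup (insertMax σ t) (inject₁ j) ∎))
      where open ≡-Reasoning

  insertMax-injective₂ : ∀ (σ σ′ : Vec (Fin n) n) t t′ →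
                         insertMax σ t ≡ insertMax σ′ t′ → σ ≡ σ′ × t ≡ t′
  insertMax-injective₂ σ σ′ t t′ eq
    with Vec.∷ʳ-injective (Vec.map (redirect t) σ) (Vec.map (redirect t′) σ′) eq
  ... | map≡map , refl = lookup-extensionality σ σ′ (λ i → redirect-injective t (begin
    redirect t (lookup σ i)              ≡⟨ Vec.lookup-map i (redirect t) σ ⟨
    lookup (Vec.map (redirect t) σ) i    ≡⟨ cong (λ v → lookup v i) map≡map ⟩
    lookup (Vec.map (redirect t) σ′) i   ≡⟨ Vec.lookup-map i (redirect t) σ′ ⟩
    redirect t (lookup σ′ i)             ∎)) , refl
    where open ≡-Reasoning

  inject₁-surjective : ∀ (y : Fin (suc n)) → y ≢ fromℕ n → ∃[ y′ ] inject₁ y′ ≡ y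
  inject₁-surjective y y≢last with view y
  ... | ‵fromℕ      = contradiction refl y≢last
  ... | ‵inject₁ y′ = y′ , refl

  -- Splicing n out of its cycle: the preimage of n is sent to the image of n instead.
  module RemoveMax (τ : Vec (Fin (suc n)) (suc n)) (τ-inj : IsInjection τ) where

    spliced : Fin n → Fin (suc n)
    spliced j with lookup τ (inject₁ j) Fin.≟ fromℕ n
    ... | yes _ = lookup τ (fromℕ n)
    ... | no  _ = lookup τ (inject₁ j)

    spliced-cases : ∀ j → (lookup τ (inject₁ j) ≡ fromℕ n × spliced j ≡ lookup τ (fromℕ n))
                        ⊎ (lookup τ (inject₁ j) ≢ fromℕ n × spliced j ≡ lookup τ (inject₁ j))
    spliced-cases j with lookup τ (inject₁ j) Fin.≟ fromℕ n
    ... | yes τj≡last = inj₁ (τj≡last , refl)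
    ... | no  τj≢last = inj₂ (τj≢last , refl)

    spliced-≢ : ∀ j → spliced j ≢ fromℕ n
    spliced-≢ j spliced≡last with spliced-cases j
    ... | inj₁ (τj≡last , spliced≡t)  =
      Fin.fromℕ≢inject₁ (τ-inj (trans (trans (sym spliced≡t) spliced≡last) (sym τj≡last)))
    ... | inj₂ (τj≢last , spliced≡τj) = τj≢last (trans (sym spliced≡τj) spliced≡last)

    removeMax : Vec (Fin n) n
    removeMax = tabulate (λ j → proj₁ (inject₁-surjective (spliced j) (spliced-≢ j)))

    inject₁-removeMax : ∀ j → inject₁ (lookup removeMax j) ≡ spliced j
    inject₁-removeMax j = trans (cong inject₁ (Vec.lookup∘tabulate _ j))
                                (proj₂ (inject₁-surjective (spliced j) (spliced-≢ j)))

    insertMax-removeMax : insertMax removeMax (lookup τ (fromℕ n)) ≡ τ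
    insertMax-removeMax = lookup-extensionality _ τ agree
      where
      t = lookup τ (fromℕ n)
      agree : ∀ i → lookup (insertMax removeMax t) i ≡ lookup τ i
      agree i with view i
      ... | ‵fromℕ     = lookup-insertMax-last removeMax t
      ... | ‵inject₁ j = trans (lookup-insertMax-inject₁ removeMax t j) (redirect-removeMax (spliced-cases j))
        where
        redirect-removeMax : _ → redirect t (lookup removeMax j) ≡ lookup τ (inject₁ j)
        redirect-removeMax (inj₁ (τj≡last , spliced≡t)) =
          trans (redirect-hit (trans (inject₁-removeMax j) spliced≡t)) (sym τj≡last)
        redirect-removeMax (inj₂ (τj≢last , spliced≡τj)) =
          trans (redirect-miss λ j′↦t →
                  Fin.fromℕ≢inject₁ (τ-inj (sym (trans (sym removed≡τj) j′↦t))))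
                removed≡τj
          where removed≡τj = trans (inject₁-removeMax j) spliced≡τj

    removeMax-injective : IsInjection removeMax
    removeMax-injective = insertMax-injective⁻ removeMax (lookup τ (fromℕ n))
                            (subst IsInjection (sym insertMax-removeMax) τ-inj)

  module _ (σ : Vec (Fin n) n) (t : Fin (suc n)) where

    private
      τ = insertMax σ t

    insertMax-step : ∀ y → lookup τ (inject₁ y) ≡ inject₁ (lookup σ y)
                         ⊎ (lookup τ (inject₁ y) ≡ fromℕ n × t ≡ inject₁ (lookup σ y))
    insertMax-step y with inject₁ (lookup σ y) Fin.≟ t
    ... | yes σy↦t = inj₂ (trans (lookup-insertMax-inject₁ σ t y) (redirect-hit σy↦t) , sym σy↦t)
    ... | no  σy↛t = inj₁ (trans (lookup-insertMax-inject₁ σ t y) (redirect-miss σy↛t))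

    orbit-forward : ∀ j k → ∃[ k′ ] iter τ k′ (inject₁ j) ≡ inject₁ (iter σ k j)
    orbit-forward j zero    = 0 , refl
    orbit-forward j (suc k) with orbit-forward j k | insertMax-step (iter σ k j)
    ... | k′ , eq | inj₁ step              = suc k′ , trans (cong (lookup τ) eq) step
    ... | k′ , eq | inj₂ (to-last , t≡σy) =
      suc (suc k′) , trans (cong (lookup τ) (trans (cong (lookup τ) eq) to-last))
                           (trans (lookup-insertMax-last σ t) t≡σy)

    orbit-backward : ∀ j k → (iter τ k (inject₁ j) ≡ fromℕ n × ∃[ k′ ] t ≡ inject₁ (iter σ k′ j))
                           ⊎ ∃[ k′ ] iter τ k (inject₁ j) ≡ inject₁ (iter σ k′ j)
    orbit-backward j zero = inj₂ (0 , refl)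
    orbit-backward j (suc k) with orbit-backward j k
    ... | inj₁ (at-last , k′ , t≡σy) =
      inj₂ (k′ , trans (cong (lookup τ) at-last) (trans (lookup-insertMax-last σ t) t≡σy))
    ... | inj₂ (k′ , eq) with insertMax-step (iter σ k′ j)
    ...   | inj₁ step              = inj₂ (suc k′ , trans (cong (lookup τ) eq) step)
    ...   | inj₂ (to-last , t≡σy) = inj₁ (trans (cong (lookup τ) eq) to-last , suc k′ , t≡σy)

    orbitMin-inject₁ : ∀ j → OrbitMin τ (inject₁ j) ⇔ OrbitMin σ j
    orbitMin-inject₁ j = mk⇔ to from
      where
      to : OrbitMin τ (inject₁ j) → OrbitMin σ j
      to min k with orbit-forward j k
      ... | k′ , eq =
        subst₂ ℕ._≤_ (Fin.toℕ-inject₁ j) (trans (cong toℕ eq) (Fin.toℕ-inject₁ _)) (min k′)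
      from : OrbitMin σ j → OrbitMin τ (inject₁ j)
      from min k with orbit-backward j k
      ... | inj₁ (at-last , _) = subst₂ ℕ._≤_ (sym (Fin.toℕ-inject₁ j))
                                   (trans (sym (Fin.toℕ-fromℕ n)) (cong toℕ (sym at-last)))
                                   (ℕ.<⇒≤ (Fin.toℕ<n j))
      ... | inj₂ (k′ , eq)     = subst₂ ℕ._≤_ (sym (Fin.toℕ-inject₁ j))
                                   (sym (trans (cong toℕ eq) (Fin.toℕ-inject₁ _))) (min k′)

    orbitMin-last : OrbitMin τ (fromℕ n) ⇔ t ≡ fromℕ n
    orbitMin-last = mk⇔ to from
      where
      to : OrbitMin τ (fromℕ n) → t ≡ fromℕ n
      to min with t Fin.≟ fromℕ n
      ... | yes t≡last = t≡last
      ... | no  t≢last with inject₁-surjective t t≢last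
      ...   | t′ , t′↦t = contradiction (min 1) (ℕ.<⇒≱ (subst₂ _<_
                (trans (sym (Fin.toℕ-inject₁ t′))
                       (cong toℕ (trans t′↦t (sym (lookup-insertMax-last σ t)))))
                (sym (Fin.toℕ-fromℕ n)) (Fin.toℕ<n t′)))
      from : t ≡ fromℕ n → OrbitMin τ (fromℕ n)
      from t≡last k = ℕ.≤-reflexive (cong toℕ (sym (fixed k)))
        where
        fixed : ∀ k → iter τ k (fromℕ n) ≡ fromℕ n
        fixed zero    = refl
        fixed (suc k) = trans (cong (lookup τ) (fixed k)) (trans (lookup-insertMax-last σ t) t≡last)

  cycles-insertMax : ∀ (σ : Vec (Fin n) n) t → IsInjection σ →
                     cycles (insertMax σ t) ≡ cycles σ + (if does (t Fin.≟ fromℕ n) then 1 else 0)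
  cycles-insertMax {n} σ t σ-inj = begin
    cycles τ
      ≡⟨ length-filter-tabulate-last (cycleMin? τ) id ⟩
    length (filter (cycleMin? τ) (List.tabulate inject₁)) + indicator (does (cycleMin? τ (fromℕ n)))
      ≡⟨ cong₂ _+_ (length-filter-tabulate-⇔ (cycleMin? τ) (cycleMin? σ) inject₁ id cycleMin-inject₁)
                   (cong indicator (does-⇔ cycleMin-last (cycleMin? τ (fromℕ n)) (t Fin.≟ fromℕ n))) ⟩
    cycles σ + indicator (does (t Fin.≟ fromℕ n))
      ∎
    where
    open ≡-Reasoning
    τ = insertMax σ t
    τ-inj = insertMax-injective σ t σ-inj
    indicator : Bool → ℕ
    indicator b = if b then 1 else 0
    cycleMin-inject₁ : ∀ j → CycleMin τ (inject₁ j) ⇔ CycleMin σ j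
    cycleMin-inject₁ j = ⇔-sym (cycleMin⇔orbitMin σ σ-inj j)
                     ⇔-∘ (orbitMin-inject₁ σ t j ⇔-∘ cycleMin⇔orbitMin τ τ-inj (inject₁ j))
    cycleMin-last : CycleMin τ (fromℕ n) ⇔ t ≡ fromℕ n
    cycleMin-last = orbitMin-last σ t ⇔-∘ cycleMin⇔orbitMin τ τ-inj (fromℕ n)

  cycles-insertMax-last : ∀ (σ : Vec (Fin n) n) → IsInjection σ →
                          cycles (insertMax σ (fromℕ n)) ≡ suc (cycles σ)
  cycles-insertMax-last {n} σ σ-inj = begin
    cycles (insertMax σ (fromℕ n))
      ≡⟨ cycles-insertMax σ (fromℕ n) σ-inj ⟩
    cycles σ + (if does (fromℕ n Fin.≟ fromℕ n) then 1 else 0)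
      ≡⟨ cong (λ b → cycles σ + (if b then 1 else 0)) (dec-true (fromℕ n Fin.≟ fromℕ n) refl) ⟩
    cycles σ + 1
      ≡⟨ ℕ.+-comm (cycles σ) 1 ⟩
    suc (cycles σ)
      ∎
    where open ≡-Reasoning

  cycles-insertMax-inject₁ : ∀ (σ : Vec (Fin n) n) j → IsInjection σ →
                             cycles (insertMax σ (inject₁ j)) ≡ cycles σ
  cycles-insertMax-inject₁ {n} σ j σ-inj = begin
    cycles (insertMax σ (inject₁ j))
      ≡⟨ cycles-insertMax σ (inject₁ j) σ-inj ⟩
    cycles σ + (if does (inject₁ j Fin.≟ fromℕ n) then 1 else 0)
      ≡⟨ cong (λ b → cycles σ + (if b then 1 else 0))
              (dec-false (inject₁ j Fin.≟ fromℕ n) (Fin.fromℕ≢inject₁ ∘ sym)) ⟩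
    cycles σ + 0
      ≡⟨ ℕ.+-identityʳ (cycles σ) ⟩
    cycles σ
      ∎
    where open ≡-Reasoning

  allVecs-unique : ∀ n k → Unique (allVecs n k)
  allVecs-unique zero    k = All.[] ∷ []
  allVecs-unique (suc n) k = consEach-unique (Unique.allFin⁺ k) (allVecs-unique n k)

  ∈-allVecs : ∀ {k} (v : Vec (Fin k) n) → v ∈ allVecs n k
  ∈-allVecs []      = here refl
  ∈-allVecs (x ∷ v) = ∈-consEach⁺ (∈-allFin x) (∈-allVecs v)

  permsWithCycles : ∀ n → ℕ → List (Vec (Fin n) n)
  permsWithCycles n k = filter (λ σ → isPerm? σ ×-dec (cycles σ ℕ.≟ k)) (allVecs n n)

  permsWithCycles-unique : ∀ n k → Unique (permsWithCycles n k)
  permsWithCycles-unique n k = Unique.filter⁺ _ (allVecs-unique n n)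

  ∈-permsWithCycles : ∀ {k} (σ : Vec (Fin n) n) →
                      σ ∈ permsWithCycles n k ⇔ (IsInjection σ × cycles σ ≡ k)
  ∈-permsWithCycles {n} {k} σ = mk⇔ to from
    where
    to : σ ∈ permsWithCycles n k → IsInjection σ × cycles σ ≡ k
    to σ∈ with ∈-filter⁻ (λ σ → isPerm? σ ×-dec (cycles σ ℕ.≟ k)) {xs = allVecs n n} σ∈
    ... | _ , perm , σ-cycles = Equivalence.to (isPerm⇔isInjection σ) perm , σ-cycles
    from : IsInjection σ × cycles σ ≡ k → σ ∈ permsWithCycles n k
    from (σ-inj , σ-cycles) =
      ∈-filter⁺ _ (∈-allVecs σ) (Equivalence.from (isPerm⇔isInjection σ) σ-inj , σ-cycles)

  insertionsAsFixedPoint : ∀ n → ℕ → List (Vec (Fin (suc n)) (suc n))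
  insertionsAsFixedPoint n k = map (λ σ → insertMax σ (fromℕ n)) (permsWithCycles n k)

  insertionsIntoCycle : ∀ n → ℕ → List (Vec (Fin (suc n)) (suc n))
  insertionsIntoCycle n k =
    List.cartesianProductWith (λ σ j → insertMax σ (inject₁ j)) (permsWithCycles n (suc k)) (allFin n)

  insertions : ∀ n → ℕ → List (Vec (Fin (suc n)) (suc n))
  insertions n k = insertionsAsFixedPoint n k ++ insertionsIntoCycle n k

  insertions-unique : ∀ n k → Unique (insertions n k)
  insertions-unique n k = Unique.++⁺
    (Unique.map⁺ (λ eq → proj₁ (insertMax-injective₂ _ _ _ _ eq)) (permsWithCycles-unique n k))
    (Unique.cartesianProductWith⁺ _
      (λ eq → let σ≡σ′ , j↦j′ = insertMax-injective₂ _ _ _ _ eq in σ≡σ′ , Fin.inject₁-injective j↦j′)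
      (permsWithCycles-unique n (suc k)) (Unique.allFin⁺ n))
    disjoint
    where
    disjoint : ∀ {τ} → τ ∈ insertionsAsFixedPoint n k × τ ∈ insertionsIntoCycle n k → ⊥
    disjoint (τ∈fixed , τ∈cycle)
      with ∈-map⁻ (λ σ → insertMax σ (fromℕ n)) τ∈fixed
         | ∈-cartesianProductWith⁻ (λ σ j → insertMax σ (inject₁ j)) (permsWithCycles n (suc k)) (allFin n) τ∈cycle
    ... | _ , _ , refl | _ , _ , _ , _ , eq = Fin.fromℕ≢inject₁ (proj₂ (insertMax-injective₂ _ _ _ _ eq))

  ∈-insertions : ∀ {k} (τ : Vec (Fin (suc n)) (suc n)) →
                 τ ∈ insertions n k ⇔ (IsInjection τ × cycles τ ≡ suc k)
  ∈-insertions {n} {k} τ = mk⇔ to from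
    where
    to : τ ∈ insertions n k → IsInjection τ × cycles τ ≡ suc k
    to τ∈ with ∈-++⁻ (insertionsAsFixedPoint n k) τ∈
    ... | inj₁ τ∈fixed with ∈-map⁻ _ τ∈fixed
    ...   | σ , σ∈ , refl = let σ-inj , σ-cycles = Equivalence.to (∈-permsWithCycles σ) σ∈
                            in insertMax-injective σ (fromℕ n) σ-inj ,
                               trans (cycles-insertMax-last σ σ-inj) (cong suc σ-cycles)
    to τ∈ | inj₂ τ∈cycle with ∈-cartesianProductWith⁻ _ (permsWithCycles n (suc k)) (allFin n) τ∈cycle
    ...   | σ , j , σ∈ , _ , refl = let σ-inj , σ-cycles = Equivalence.to (∈-permsWithCycles σ) σ∈
                                    in insertMax-injective σ (inject₁ j) σ-inj ,
                                       trans (cycles-insertMax-inject₁ σ j σ-inj) σ-cycles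
    insertMax-∈ : ∀ σ t → IsInjection σ → cycles (insertMax σ t) ≡ suc k → insertMax σ t ∈ insertions n k
    insertMax-∈ σ t σ-inj τ-cycles with view t
    ... | ‵fromℕ     = ∈-++⁺ˡ (∈-map⁺ _ (Equivalence.from (∈-permsWithCycles σ)
                        (σ-inj , ℕ.suc-injective (trans (sym (cycles-insertMax-last σ σ-inj)) τ-cycles))))
    ... | ‵inject₁ j = ∈-++⁺ʳ _ (∈-cartesianProductWith⁺ _ (Equivalence.from (∈-permsWithCycles σ)
                        (σ-inj , trans (sym (cycles-insertMax-inject₁ σ j σ-inj)) τ-cycles)) (∈-allFin j))
    from : IsInjection τ × cycles τ ≡ suc k → τ ∈ insertions n k
    from (τ-inj , τ-cycles) = subst (_∈ insertions n k) insertMax-removeMax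
      (insertMax-∈ removeMax _ removeMax-injective (trans (cong cycles insertMax-removeMax) τ-cycles))
      where open RemoveMax τ τ-inj

  stirling1-suc-suc : ∀ n k → stirling1 (suc n) (suc k) ≡ n * stirling1 n (suc k) + stirling1 n k
  stirling1-suc-suc n k = begin
    stirling1 (suc n) (suc k)
      ≡⟨ same-members⇒length≡ (permsWithCycles-unique (suc n) (suc k)) (insertions-unique n k)
           (λ {τ} → ⇔-sym (∈-insertions τ) ⇔-∘ ∈-permsWithCycles τ) ⟩
    length (insertions n k)
      ≡⟨ List.length-++ (insertionsAsFixedPoint n k) ⟩
    length (insertionsAsFixedPoint n k) + length (insertionsIntoCycle n k)
      ≡⟨ cong₂ _+_ (List.length-map _ (permsWithCycles n k))
                   (length-cartesianProductWith _ (permsWithCycles n (suc k)) (allFin n)) ⟩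
    stirling1 n k + stirling1 n (suc k) * length (allFin n)
      ≡⟨ cong (λ l → stirling1 n k + stirling1 n (suc k) * l) (List.length-tabulate id) ⟩
    stirling1 n k + stirling1 n (suc k) * n
      ≡⟨ ℕ.+-comm (stirling1 n k) _ ⟩
    stirling1 n (suc k) * n + stirling1 n k
      ≡⟨ cong (_+ stirling1 n k) (ℕ.*-comm (stirling1 n (suc k)) n) ⟩
    n * stirling1 n (suc k) + stirling1 n k
      ∎
    where open ≡-Reasoning

  stirling1-suc-zero : ∀ n → stirling1 (suc n) 0 ≡ 0
  stirling1-suc-zero n = cong length
    (List.filter-none (λ σ → isPerm? σ ×-dec (cycles σ ℕ.≟ 0)) {xs = allVecs (suc n) (suc n)}
                      (All.tabulate λ {σ} _ → has-cycle σ ∘ proj₂))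
    where
    has-cycle : ∀ (σ : Vec (Fin (suc n)) (suc n)) → cycles σ ≢ 0
    has-cycle σ =
      ℕ.n>0⇒n≢0 (List.filter-some (cycleMin? σ) (here (All.applyUpTo⁺₁ id (suc n) (λ _ → z≤n))))

module RisingFactorials where

  open StirlingRecurrence using (stirling1-suc-suc; stirling1-suc-zero)

  open import Data.Fin using (Fin; toℕ; inject₁; fromℕ)
  import Data.Fin.Properties as Fin
  open import Data.Integer using (ℤ; +_; -_; _+_; _-_; _*_; _^_)
  import Data.Integer.Properties as ℤ
  open import Algebra.Properties.Semiring.Sum ℤ.+-*-semiring
    using (sum-syntax; sum-cong-≗; sum-init-last; ∑-distrib-+; *-distribˡ-sum)
  open import Data.Integer.Tactic.RingSolver using (solve-∀)
  open import Data.List using (applyUpTo)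
  import Data.List.Properties as List
  open import Data.Nat as ℕ using (ℕ; zero; suc; _<_; s≤s; _!)
  import Data.Nat.Properties as ℕ
  open import Function using (_∘_; id)
  open import Relation.Binary.PropositionalEquality
  open ≡-Reasoning

  sum-last : ∀ n (g : ℕ → ℤ) → ∑[ k < suc n ] g (toℕ k) ≡ ∑[ k < n ] g (toℕ k) + g n
  sum-last n g = begin
    ∑[ k < suc n ] g (toℕ k)
      ≡⟨ sum-init-last {n} (g ∘ toℕ) ⟩
    ∑[ k < n ] g (toℕ (inject₁ k)) + g (toℕ (fromℕ n))
      ≡⟨ cong₂ _+_ (sum-cong-≗ {n} (cong g ∘ Fin.toℕ-inject₁)) (cong g (Fin.toℕ-fromℕ n)) ⟩
    ∑[ k < n ] g (toℕ k) + g n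
      ∎

  sumℤ-applyUpTo : ∀ (g : ℕ → ℤ) n → sumℤ (applyUpTo g n) ≡ ∑[ k < n ] g (toℕ k)
  sumℤ-applyUpTo g zero    = refl
  sumℤ-applyUpTo g (suc n) = cong (_+_ (g 0)) (sumℤ-applyUpTo (g ∘ suc) n)

  -- Multiplication by z on coefficient sequences.
  shift : (ℕ → ℤ) → ℕ → ℤ
  shift c zero    = + 0
  shift c (suc k) = c k

  shift-cong : ∀ {c d : ℕ → ℤ} → (∀ i → c i ≡ d i) → ∀ k → shift c k ≡ shift d k
  shift-cong c≡d zero    = refl
  shift-cong c≡d (suc k) = c≡d k

  shift-linear : ∀ a (c d : ℕ → ℤ) k → shift (λ i → a * c i + d i) k ≡ a * shift c k + shift d k
  shift-linear a c d zero    = sym (trans (cong (_+ + 0) (ℤ.*-zeroʳ a)) (ℤ.+-identityʳ (+ 0)))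
  shift-linear a c d (suc k) = refl

  -- risingCoeff x n k is the coefficient of zᵏ in (x + z)(x + 1 + z) ⋯ (x + n - 1 + z).
  risingCoeff : ℤ → ℕ → ℕ → ℤ
  risingCoeff x zero    zero    = + 1
  risingCoeff x zero    (suc k) = + 0
  risingCoeff x (suc n) k       = x * risingCoeff (x + + 1) n k + shift (risingCoeff (x + + 1) n) k

  risingCoeff-vanish : ∀ x n k → n < k → risingCoeff x n k ≡ + 0
  risingCoeff-vanish x zero    (suc k) _         = refl
  risingCoeff-vanish x (suc n) (suc k) (s≤s n<k) = begin
    x * risingCoeff (x + + 1) n (suc k) + risingCoeff (x + + 1) n k
      ≡⟨ cong₂ (λ u v → x * u + v) (risingCoeff-vanish (x + + 1) n (suc k) (ℕ.m<n⇒m<1+n n<k))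
                                   (risingCoeff-vanish (x + + 1) n k n<k) ⟩
    x * + 0 + + 0
      ≡⟨ cong (_+ + 0) (ℤ.*-zeroʳ x) ⟩
    + 0
      ∎

  -- Multiplying out the last factor instead of the first.
  risingCoeff-suc-last : ∀ x n k →
    risingCoeff x (suc n) k ≡ (x + + n) * risingCoeff x n k + shift (risingCoeff x n) k
  risingCoeff-suc-last x zero    zero          = cong (λ y → y * + 1 + + 0) (sym (ℤ.+-identityʳ x))
  risingCoeff-suc-last x zero    (suc zero)    = cong (λ y → y * + 0 + + 1) (sym (ℤ.+-identityʳ x))
  risingCoeff-suc-last x zero    (suc (suc k)) = cong (λ y → y * + 0 + + 0) (sym (ℤ.+-identityʳ x))
  risingCoeff-suc-last x (suc n) k             = begin
    x * R (suc n) k + shift (R (suc n)) k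
      ≡⟨ cong₂ (λ u v → x * u + v) (risingCoeff-suc-last (x + + 1) n k)
                                   (shift-cong (risingCoeff-suc-last (x + + 1) n) k) ⟩
    x * (x′ * R n k + S) + shift (λ i → x′ * R n i + shift (R n) i) k
      ≡⟨ cong (_+_ (x * (x′ * R n k + S))) (shift-linear x′ (R n) (shift (R n)) k) ⟩
    x * (x′ * R n k + S) + (x′ * S + shift (shift (R n)) k)
      ≡⟨ regroup x (+ n) (R n k) S (shift (shift (R n)) k) ⟩
    (x + (+ 1 + + n)) * (x * R n k + S) + (x * S + shift (shift (R n)) k)
      ≡⟨ cong₂ (λ m u → (x + m) * (x * R n k + S) + u)
               (sym (ℤ.pos-+ 1 n)) (sym (shift-linear x (R n) (shift (R n)) k)) ⟩
    (x + + suc n) * risingCoeff x (suc n) k + shift (risingCoeff x (suc n)) k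
      ∎
    where
    R = risingCoeff (x + + 1)
    x′ = x + + 1 + + n
    S = shift (R n) k
    regroup : ∀ x N a b c → x * ((x + + 1 + N) * a + b) + ((x + + 1 + N) * b + c)
                          ≡ (x + (+ 1 + N)) * (x * a + b) + (x * b + c)
    regroup = solve-∀

  risingCoeff-one : ∀ n k → risingCoeff (+ 1) n k ≡ + stirling1 (suc n) (suc k)
  risingCoeff-one zero    zero    = refl
  risingCoeff-one zero    (suc k) = refl
  risingCoeff-one (suc n) k       = begin
    risingCoeff (+ 1) (suc n) k
      ≡⟨ risingCoeff-suc-last (+ 1) n k ⟩
    (+ 1 + + n) * risingCoeff (+ 1) n k + shift (risingCoeff (+ 1) n) k
      ≡⟨ cong₂ (λ u v → u * risingCoeff (+ 1) n k + v)
               (sym (ℤ.pos-+ 1 n)) (shift-cong (risingCoeff-one n) k) ⟩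
    + suc n * risingCoeff (+ 1) n k + shift (λ i → + stirling1 (suc n) (suc i)) k
      ≡⟨ cong₂ (λ u v → + suc n * u + v) (risingCoeff-one n k) (shift-stirling1 k) ⟩
    + suc n * + stirling1 (suc n) (suc k) + + stirling1 (suc n) k
      ≡⟨ cong (_+ + stirling1 (suc n) k) (ℤ.pos-* (suc n) _) ⟨
    + (suc n ℕ.* stirling1 (suc n) (suc k)) + + stirling1 (suc n) k
      ≡⟨ ℤ.pos-+ (suc n ℕ.* stirling1 (suc n) (suc k)) (stirling1 (suc n) k) ⟨
    + (suc n ℕ.* stirling1 (suc n) (suc k) ℕ.+ stirling1 (suc n) k)
      ≡⟨ cong +_ (stirling1-suc-suc (suc n) k) ⟨
    + stirling1 (suc (suc n)) (suc k)
      ∎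
    where
    shift-stirling1 : ∀ k → shift (λ i → + stirling1 (suc n) (suc i)) k ≡ + stirling1 (suc n) k
    shift-stirling1 zero    = cong +_ (sym (stirling1-suc-zero n))
    shift-stirling1 (suc k) = refl

  fallingFactorial : ℤ → ℕ → ℤ
  fallingFactorial z zero    = + 1
  fallingFactorial z (suc k) = z * fallingFactorial (z - + 1) k

  fallingFactorial-suc-last : ∀ z k → fallingFactorial z (suc k) ≡ fallingFactorial z k * (z - + k)
  fallingFactorial-suc-last z zero    = unit z
    where
    unit : ∀ z → z * + 1 ≡ + 1 * (z - + 0)
    unit = solve-∀
  fallingFactorial-suc-last z (suc k) = begin
    z * F (suc k)                 ≡⟨ cong (z *_) (fallingFactorial-suc-last (z - + 1) k) ⟩
    z * (F k * (z - + 1 - + k))   ≡⟨ regroup z (F k) (+ k) ⟩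
    z * F k * (z - (+ 1 + + k))   ≡⟨ cong (λ m → z * F k * (z - m)) (ℤ.pos-+ 1 k) ⟨
    z * F k * (z - + suc k)       ∎
    where
    F = fallingFactorial (z - + 1)
    regroup : ∀ z f k → z * (f * (z - + 1 - k)) ≡ z * f * (z - (+ 1 + k))
    regroup = solve-∀

  fallingFactorial-minus-one : ∀ k → fallingFactorial (- + 1) k ≡ (- + 1) ^ k * + (k !)
  fallingFactorial-minus-one zero    = refl
  fallingFactorial-minus-one (suc k) = begin
    fallingFactorial (- + 1) (suc k)
      ≡⟨ fallingFactorial-suc-last (- + 1) k ⟩
    fallingFactorial (- + 1) k * (- + 1 - + k)
      ≡⟨ cong (_* (- + 1 - + k)) (fallingFactorial-minus-one k) ⟩
    (- + 1) ^ k * + (k !) * (- + 1 - + k)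
      ≡⟨ regroup ((- + 1) ^ k) (+ (k !)) (+ k) ⟩
    - + 1 * (- + 1) ^ k * ((+ 1 + + k) * + (k !))
      ≡⟨ cong (λ m → - + 1 * (- + 1) ^ k * (m * + (k !))) (ℤ.pos-+ 1 k) ⟨
    - + 1 * (- + 1) ^ k * (+ suc k * + (k !))
      ≡⟨ cong (- + 1 * (- + 1) ^ k *_) (ℤ.pos-* (suc k) (k !)) ⟨
    (- + 1) ^ suc k * + (suc k !)
      ∎
    where
    regroup : ∀ s f k → s * f * (- + 1 - k) ≡ - + 1 * s * ((+ 1 + k) * f)
    regroup = solve-∀

  -- The polynomial (x + z)(x + 1 + z) ⋯ (x + n - 1 + z) with every power zᵏ replaced by
  -- the falling factorial z(z - 1) ⋯ (z - k + 1).
  umbral : ℤ → ℤ → ℕ → ℤ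
  umbral x z n = ∑[ k < suc n ] (fallingFactorial z (toℕ k) * risingCoeff x n (toℕ k))

  umbral-one-more-term : ∀ x z n →
    ∑[ k < suc (suc n) ] (fallingFactorial z (toℕ k) * risingCoeff x n (toℕ k)) ≡ umbral x z n
  umbral-one-more-term x z n = begin
    ∑[ k < suc (suc n) ] (F (toℕ k) * R (toℕ k)) ≡⟨ sum-last (suc n) (λ k → F k * R k) ⟩
    umbral x z n + F (suc n) * R (suc n)        ≡⟨ cong (λ r → umbral x z n + F (suc n) * r)
                                                        (risingCoeff-vanish x n (suc n) (ℕ.n<1+n n)) ⟩
    umbral x z n + F (suc n) * + 0              ≡⟨ cong (_+_ (umbral x z n)) (ℤ.*-zeroʳ (F (suc n))) ⟩
    umbral x z n + + 0                          ≡⟨ ℤ.+-identityʳ _ ⟩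
    umbral x z n                                ∎
    where
    F = fallingFactorial z
    R = risingCoeff x n

  umbral-suc : ∀ x z n → umbral x z (suc n) ≡ x * umbral (x + + 1) z n + z * umbral (x + + 1) (z - + 1) n
  umbral-suc x z n = begin
    ∑[ k < suc (suc n) ] (F z (toℕ k) * (x * R (toℕ k) + shift R (toℕ k)))
      ≡⟨ sum-cong-≗ {suc (suc n)} (λ k → distribute x (F z (toℕ k)) (R (toℕ k)) (shift R (toℕ k))) ⟩
    ∑[ k < suc (suc n) ] (x * term z k + F z (toℕ k) * shift R (toℕ k))
      ≡⟨ ∑-distrib-+ {suc (suc n)} (λ k → x * term z k) (λ k → F z (toℕ k) * shift R (toℕ k)) ⟩
    ∑[ k < suc (suc n) ] (x * term z k) + ∑[ k < suc (suc n) ] (F z (toℕ k) * shift R (toℕ k))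
      ≡⟨ cong₂ _+_ (sym (*-distribˡ-sum {suc (suc n)} x (term z)))
                   (trans (ℤ.+-identityˡ _)
                          (trans (sum-cong-≗ {suc n} (λ k → ℤ.*-assoc z (F (z - + 1) (toℕ k)) (R (toℕ k))))
                                 (sym (*-distribˡ-sum {suc n} z (term (z - + 1)))))) ⟩
    x * ∑[ k < suc (suc n) ] term z k + z * umbral (x + + 1) (z - + 1) n
      ≡⟨ cong (λ s → x * s + z * umbral (x + + 1) (z - + 1) n) (umbral-one-more-term (x + + 1) z n) ⟩
    x * umbral (x + + 1) z n + z * umbral (x + + 1) (z - + 1) n
      ∎
    where
    F = fallingFactorial
    R = risingCoeff (x + + 1) n
    term : ∀ {l} → ℤ → Fin l → ℤ
    term w k = F w (toℕ k) * R (toℕ k)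
    distribute : ∀ x f r s → f * (x * r + s) ≡ x * (f * r) + f * s
    distribute = solve-∀

  treePoly : ℕ → ℤ → ℤ → ℤ
  treePoly zero    x y = + 1
  treePoly (suc m) x y = x * treePoly m (x + + 1) (y + + 1) + (y - x) * treePoly m (x + + 1) y

  treePoly≡umbral : ∀ m x y → treePoly m x y ≡ umbral x (y - x) m
  treePoly≡umbral zero    x y = refl
  treePoly≡umbral (suc m) x y = begin
    x * treePoly m (x + + 1) (y + + 1) + (y - x) * treePoly m (x + + 1) y
      ≡⟨ cong₂ (λ u v → x * u + (y - x) * v)
               (treePoly≡umbral m (x + + 1) (y + + 1)) (treePoly≡umbral m (x + + 1) y) ⟩
    x * umbral (x + + 1) (y + + 1 - (x + + 1)) m + (y - x) * umbral (x + + 1) (y - (x + + 1)) m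
      ≡⟨ cong₂ (λ u v → x * umbral (x + + 1) u m + (y - x) * umbral (x + + 1) v m)
               (shift-both x y) (shift-one x y) ⟩
    x * umbral (x + + 1) (y - x) m + (y - x) * umbral (x + + 1) (y - x - + 1) m
      ≡⟨ umbral-suc x (y - x) m ⟨
    umbral x (y - x) (suc m)
      ∎
    where
    shift-both : ∀ x y → y + + 1 - (x + + 1) ≡ y - x
    shift-both = solve-∀
    shift-one : ∀ x y → y - (x + + 1) ≡ y - x - + 1
    shift-one = solve-∀

  a≡umbral : ∀ m → a (suc m) ≡ umbral (+ 1) (- + 1) m
  a≡umbral m = begin
    a (suc m)
      ≡⟨ cong sumℤ (List.map-applyUpTo id term (suc m)) ⟩
    sumℤ (applyUpTo term (suc m))
      ≡⟨ sumℤ-applyUpTo term (suc m) ⟩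
    ∑[ k < suc m ] term (toℕ k)
      ≡⟨ sum-cong-≗ {suc m} (λ k → cong₂ _*_ (sym (fallingFactorial-minus-one (toℕ k)))
                                              (sym (risingCoeff-one m (toℕ k)))) ⟩
    umbral (+ 1) (- + 1) m
      ∎
    where
    term : ℕ → ℤ
    term j = (- + 1) ^ j * + (j !) * + stirling1 (suc m) (suc j)

  a≡treePoly : ∀ m → a (suc m) ≡ treePoly m (+ 1) (+ 0)
  a≡treePoly m = trans (a≡umbral m) (sym (treePoly≡umbral m (+ 1) (+ 0)))

module GameTrees where

  open Enumeration
  open RisingFactorials using (treePoly)

  open import Data.Bool using (Bool; true; false; not; _∧_; _∨_; if_then_else_)
  import Data.Bool.Properties as Bool
  open import Data.Empty using (⊥; ⊥-elim)
  open import Data.Fin as Fin using (Fin; zero; suc; toℕ)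
  open import Data.Integer using (ℤ; +_; _+_; _-_; _*_)
  import Data.Integer.Properties as ℤ
  open import Data.Integer.Tactic.RingSolver using (solve-∀)
  open import Data.List using (List; []; _∷_; map; concatMap; filter; length)
  open import Data.List.Membership.Propositional using (_∈_; find)
  import Data.List.Membership.Propositional as Membership
  open import Data.List.Membership.Propositional.Properties
    using (∈-map⁺; ∈-map⁻; ∈-concatMap⁺; ∈-concatMap⁻; ∈-filter⁺; ∈-filter⁻)
  import Data.List.Relation.Unary.All as All
  open import Data.List.Relation.Unary.AllPairs using ([]; _∷_)
  open import Data.List.Relation.Unary.Any using (here; there)
  open import Data.List.Relation.Unary.Unique.Propositional using (Unique)
  import Data.List.Relation.Unary.Unique.Propositional.Properties as Unique
  open import Data.Nat as ℕ using (ℕ; zero; suc; _<_; z≤n; s≤s)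
  import Data.Nat.Properties as ℕ
  open import Data.Product using (∃-syntax; _×_; _,_)
  open import Data.Vec as Vec using (Vec; []; _∷_; lookup)
  import Data.Vec.Properties as Vec
  open import Function.Bundles using (_⇔_; mk⇔; Equivalence)
  open import Relation.Binary.PropositionalEquality
  open import Relation.Nullary using (does; yes; no; contradiction)

  private
    variable
      k m n : ℕ

  -- Merges vertex 1 (labelled 2) into the root.
  contract : Fin (suc (suc m)) → Fin (suc m)
  contract zero          = zero
  contract (suc zero)    = zero
  contract (suc (suc j)) = suc j

  contractFibre : Fin (suc m) → List (Fin (suc (suc m)))
  contractFibre zero    = zero ∷ suc zero ∷ []
  contractFibre (suc j) = suc (suc j) ∷ []

  ∈-contractFibre : ∀ (a : Fin (suc (suc m))) → a ∈ contractFibre (contract a)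
  ∈-contractFibre zero          = here refl
  ∈-contractFibre (suc zero)    = there (here refl)
  ∈-contractFibre (suc (suc j)) = here refl

  contract-∈-contractFibre : ∀ (u : Fin (suc m)) {a} → a ∈ contractFibre u → contract a ≡ u
  contract-∈-contractFibre zero    (here refl)         = refl
  contract-∈-contractFibre zero    (there (here refl)) = refl
  contract-∈-contractFibre (suc j) (here refl)         = refl

  contractFibre-unique : ∀ (u : Fin (suc m)) → Unique (contractFibre u)
  contractFibre-unique zero    = ((λ ()) All.∷ All.[]) ∷ All.[] ∷ []
  contractFibre-unique (suc j) = All.[] ∷ []

  expansions : Vec (Fin (suc m)) k → List (Vec (Fin (suc (suc m))) k)
  expansions q = choices (Vec.map contractFibre q)

  ∈-expansions : ∀ (r : Vec (Fin (suc (suc m))) k) → r ∈ expansions (Vec.map contract r)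
  ∈-expansions []      = here refl
  ∈-expansions (a ∷ r) = ∈-consEach⁺ (∈-contractFibre a) (∈-expansions r)

  contract-∈-expansions : ∀ (q : Vec (Fin (suc m)) k) {r} → r ∈ expansions q → Vec.map contract r ≡ q
  contract-∈-expansions []      (here refl) = refl
  contract-∈-expansions (u ∷ q) {a ∷ r} ar∈ =
    let a∈ , r∈ = ∈-consEach⁻ (contractFibre u) (expansions q) ar∈
    in cong₂ _∷_ (contract-∈-contractFibre u a∈) (contract-∈-expansions q r∈)

  expansions-unique : ∀ (q : Vec (Fin (suc m)) k) → Unique (expansions q)
  expansions-unique q = choices-unique (Vec.map contractFibre q) λ i →
    subst Unique (sym (Vec.lookup-map i contractFibre q)) (contractFibre-unique (lookup q i))

  increasingTrees : ∀ m → List (ParentMap m)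
  increasingTrees zero    = [] ∷ []
  increasingTrees (suc m) = concatMap (λ q → map (zero ∷_) (expansions q)) (increasingTrees m)

  contract-<⇔ : ∀ (a : Fin (suc (suc m))) i → toℕ (contract a) < suc i ⇔ toℕ a < suc (suc i)
  contract-<⇔ zero          i = mk⇔ (λ _ → s≤s z≤n) (λ _ → s≤s z≤n)
  contract-<⇔ (suc zero)    i = mk⇔ (λ _ → s≤s (s≤s z≤n)) (λ _ → s≤s z≤n)
  contract-<⇔ (suc (suc j)) i = mk⇔ s≤s ℕ.≤-pred

  isIncreasing-contract : ∀ x (r : Vec (Fin (suc (suc m))) m) →
                          IsIncreasing (x ∷ r) → x ≡ zero × IsIncreasing (Vec.map contract r)
  isIncreasing-contract (suc x) r inc with inc zero
  ... | s≤s ()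
  isIncreasing-contract zero    r inc = refl , λ i →
    subst (λ u → toℕ u < suc (toℕ i)) (sym (Vec.lookup-map i contract r))
          (Equivalence.from (contract-<⇔ (lookup r i) (toℕ i)) (inc (suc i)))

  isIncreasing-expand : ∀ (r : Vec (Fin (suc (suc m))) m) →
                        IsIncreasing (Vec.map contract r) → IsIncreasing (zero ∷ r)
  isIncreasing-expand r inc zero    = s≤s z≤n
  isIncreasing-expand r inc (suc i) = Equivalence.to (contract-<⇔ (lookup r i) (toℕ i))
    (subst (λ u → toℕ u < suc (toℕ i)) (Vec.lookup-map i contract r) (inc i))

  ∈-increasingTrees : ∀ (p : ParentMap m) → p ∈ increasingTrees m ⇔ IsIncreasing p
  ∈-increasingTrees p = mk⇔ (to p) (from p)
    where
    to : ∀ {m} (p : ParentMap m) → p ∈ increasingTrees m → IsIncreasing p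
    to {zero}  [] _ ()
    to {suc m} p p∈
      with find (∈-concatMap⁻ (λ q → map (zero ∷_) (expansions q)) {xs = increasingTrees m} p∈)
    ... | q , q∈ , p∈q with ∈-map⁻ (zero ∷_) p∈q
    ... | r , r∈ , refl =
      isIncreasing-expand r (subst IsIncreasing (sym (contract-∈-expansions q r∈)) (to q q∈))
    from : ∀ {m} (p : ParentMap m) → IsIncreasing p → p ∈ increasingTrees m
    from {zero}  []      _   = here refl
    from {suc m} (x ∷ r) inc with isIncreasing-contract x r inc
    ... | refl , inc-q =
      ∈-concatMap⁺ _ (Membership.lose (from (Vec.map contract r) inc-q) (∈-map⁺ (zero ∷_) (∈-expansions r)))

  increasingTrees-unique : ∀ m → Unique (increasingTrees m)
  increasingTrees-unique zero    = All.[] ∷ []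
  increasingTrees-unique (suc m) =
    concatMap-unique _ (increasingTrees-unique m) (λ q → Unique.map⁺ Vec.∷-injectiveʳ (expansions-unique q))
                     same-contraction
    where
    same-contraction : ∀ {q q′ p} → p ∈ map (zero ∷_) (expansions q) → p ∈ map (zero ∷_) (expansions q′) →
                       q ≡ q′
    same-contraction {q} {q′} p∈ p∈′ with ∈-map⁻ (zero ∷_) p∈ | ∈-map⁻ (zero ∷_) p∈′
    ... | r , r∈ , refl | r′ , r′∈ , refl =
      trans (sym (contract-∈-expansions q r∈)) (contract-∈-expansions q′ r′∈)

  hasLosingChild : Fin k → Vec (Fin k) n → Vec Bool n → Bool
  hasLosingChild v []       []       = false
  hasLosingChild v (u ∷ us) (s ∷ ss) = (does (u Fin.≟ v) ∧ not s) ∨ hasLosingChild v us ss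

  hasLosingChild-true : ∀ (v : Fin k) (us : Vec (Fin k) n) ss → hasLosingChild v us ss ≡ true →
                        ∃[ i ] lookup us i ≡ v × lookup ss i ≡ false
  hasLosingChild-true v []       []       ()
  hasLosingChild-true v (u ∷ us) (s ∷ ss) eq with u Fin.≟ v | s
  ... | yes u≡v | false = zero , u≡v , refl
  ... | yes _   | true  = let i , found = hasLosingChild-true v us ss eq in suc i , found
  ... | no  _   | _     = let i , found = hasLosingChild-true v us ss eq in suc i , found

  hasLosingChild-false : ∀ (v : Fin k) (us : Vec (Fin k) n) ss → hasLosingChild v us ss ≡ false →
                         ∀ i → lookup us i ≡ v → lookup ss i ≡ true
  hasLosingChild-false v (u ∷ us) (s ∷ ss) eq zero u≡v with u Fin.≟ v | s
  ... | yes _   | true = refl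
  ... | no  u≢v | _    = contradiction u≡v u≢v
  hasLosingChild-false v (u ∷ us) (s ∷ ss) eq (suc i) u≡v =
    hasLosingChild-false v us ss (Bool.∨-conicalʳ _ _ eq) i u≡v

  data Outcome (p : ParentMap m) (v : Fin (suc m)) : Bool → Set where
    wins  : Win p v  → Outcome p v true
    loses : Lose p v → Outcome p v false

  win-lose-exclusive : ∀ {p : ParentMap m} {v} → Win p v → Lose p v → ⊥
  win-lose-exclusive (win i i↦v lost) (lose all-win) = win-lose-exclusive (all-win i i↦v) lost

  outcome-lose : ∀ {p : ParentMap m} {v b} → Outcome p v b → Lose p v → b ≡ false
  outcome-lose (wins w)  l = ⊥-elim (win-lose-exclusive w l)
  outcome-lose (loses _) _ = refl

  outcome-by-children : ∀ (p : ParentMap m) (st : Vec Bool m) v →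
    (∀ i → lookup p i ≡ v → Outcome p (suc i) (lookup st i)) → Outcome p v (hasLosingChild v p st)
  outcome-by-children p st v children with hasLosingChild v p st in eq
  ... | true  = let i , i↦v , lost = hasLosingChild-true v p st eq
                in wins (win i i↦v (lost-child (children i i↦v) lost))
    where
    lost-child : ∀ {i b} → Outcome p (suc i) b → b ≡ false → Lose p (suc i)
    lost-child (loses l) refl = l
  ... | false = loses (lose λ i i↦v → won-child (children i i↦v) (hasLosingChild-false v p st eq i i↦v))
    where
    won-child : ∀ {i b} → Outcome p (suc i) b → b ≡ true → Win p (suc i)
    won-child (wins w) refl = w

  contract-suc : ∀ {a : Fin (suc (suc m))} {j} → contract a ≡ suc j → a ≡ suc (suc j)
  contract-suc {a = suc (suc _)} refl = refl

  mutual
    win-expand : ∀ (r : Vec (Fin (suc (suc m))) m) {j} →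
                 Win (Vec.map contract r) (suc j) → Win (zero ∷ r) (suc (suc j))
    win-expand r (win i i↦j lost) =
      win (suc i) (contract-suc (trans (sym (Vec.lookup-map i contract r)) i↦j)) (lose-expand r lost)

    lose-expand : ∀ (r : Vec (Fin (suc (suc m))) m) {j} →
                  Lose (Vec.map contract r) (suc j) → Lose (zero ∷ r) (suc (suc j))
    lose-expand r (lose all-win) = lose λ where
      (suc i) i↦j → win-expand r (all-win i (trans (Vec.lookup-map i contract r) (cong contract i↦j)))

  outcome-expand : ∀ (r : Vec (Fin (suc (suc m))) m) {j b} →
                   Outcome (Vec.map contract r) (suc j) b → Outcome (zero ∷ r) (suc (suc j)) b
  outcome-expand r (wins w)  = wins (win-expand r w)
  outcome-expand r (loses l) = loses (lose-expand r l)

  -- Entry i tells whether the player to move at vertex i + 1 wins. It is computed along the recursion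
  -- of increasingTrees, since contracting vertex 1 into the root leaves every other subtree intact.
  childStatus : ParentMap m → Vec Bool m
  childStatus {zero}  []      = []
  childStatus {suc m} (_ ∷ r) = hasLosingChild (suc zero) r below ∷ below
    where below = childStatus (Vec.map contract r)

  rootStatus : ParentMap m → Bool
  rootStatus p = hasLosingChild zero p (childStatus p)

  childStatus-correct : ∀ (p : ParentMap m) → IsIncreasing p →
                        ∀ i → Outcome p (suc i) (lookup (childStatus p) i)
  childStatus-correct {suc m} (x ∷ r) inc with isIncreasing-contract x r inc
  ... | refl , inc-q = outcome
    where
    q = Vec.map contract r
    above-one : ∀ j → Outcome (zero ∷ r) (suc (suc j)) (lookup (childStatus q) j)
    above-one j = outcome-expand r (childStatus-correct q inc-q j)
    outcome : ∀ i → Outcome (zero ∷ r) (suc i) (lookup (childStatus (zero ∷ r)) i)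
    outcome zero    = outcome-by-children (zero ∷ r) (childStatus (zero ∷ r)) (suc zero) λ where
      (suc j) _ → above-one j
    outcome (suc j) = above-one j

  rootStatus-correct : ∀ (p : ParentMap m) → IsIncreasing p → Outcome p zero (rootStatus p)
  rootStatus-correct p inc =
    outcome-by-children p (childStatus p) zero (λ i _ → childStatus-correct p inc i)

  rootWeight : ℤ → ℤ → Fin k → Bool → ℤ
  rootWeight x y zero    true  = x
  rootWeight x y zero    false = y
  rootWeight x y (suc _) _     = + 1

  -- x ^ (number of winning children of the root) * y ^ (number of losing children of the root)
  weight : ℤ → ℤ → ParentMap m → ℤ
  weight x y p = prodWith (rootWeight x y) p (childStatus p)

  weightSum : ℕ → ℤ → ℤ → ℤ
  weightSum m x y = ∑[ p ∈ increasingTrees m ] weight x y p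

  notLosingChildOf : Fin k → Fin k → Bool → ℤ
  notLosingChildOf v u s = if does (u Fin.≟ v) ∧ not s then + 0 else + 1

  noLosingChild-indicator : ∀ (v : Fin k) (us : Vec (Fin k) n) ss →
    (if hasLosingChild v us ss then + 0 else + 1) ≡ prodWith (notLosingChildOf v) us ss
  noLosingChild-indicator v []       []       = refl
  noLosingChild-indicator v (u ∷ us) (s ∷ ss) with does (u Fin.≟ v) ∧ not s
  ... | true  = sym (ℤ.*-zeroˡ (prodWith (notLosingChildOf v) us ss))
  ... | false = trans (noLosingChild-indicator v us ss) (sym (ℤ.*-identityˡ _))

  weight-one-zero : ∀ (p : ParentMap m) → weight (+ 1) (+ 0) p ≡ (if rootStatus p then + 0 else + 1)
  weight-one-zero p = sym (trans (noLosingChild-indicator zero p (childStatus p))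
                                 (prodWith-cong same-factor p (childStatus p)))
    where
    same-factor : ∀ (u : Fin _) s → notLosingChildOf zero u s ≡ rootWeight (+ 1) (+ 0) u s
    same-factor zero    true  = refl
    same-factor zero    false = refl
    same-factor (suc _) _     = refl

  ∑-expansions : ∀ {f : Fin (suc (suc m)) → Bool → ℤ} {g : Fin (suc m) → Bool → ℤ} →
    (∀ u s → ∑[ a ∈ contractFibre u ] f a s ≡ g u s) →
    ∀ (q : Vec (Fin (suc m)) k) ss → ∑[ r ∈ expansions q ] prodWith f r ss ≡ prodWith g q ss
  ∑-expansions {f = f} fibre q ss =
    trans (∑-choices f (Vec.map contractFibre q) ss)
          (trans (prodWith-map _ contractFibre q ss) (prodWith-cong fibre q ss))

  ∑-fibre-rootWeight : ∀ x y (u : Fin (suc m)) s →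
    ∑[ a ∈ contractFibre u ] rootWeight x y a s ≡ rootWeight (x + + 1) (y + + 1) u s
  ∑-fibre-rootWeight x y zero    true  = refl
  ∑-fibre-rootWeight x y zero    false = refl
  ∑-fibre-rootWeight x y (suc _) _     = refl

  ∑-fibre-rootWeight-notLosing : ∀ x y (u : Fin (suc m)) s →
    ∑[ a ∈ contractFibre u ] rootWeight x y a s * notLosingChildOf (suc zero) a s
      ≡ rootWeight (x + + 1) y u s
  ∑-fibre-rootWeight-notLosing x y zero    true  = cong (_+ + 1) (ℤ.*-identityʳ x)
  ∑-fibre-rootWeight-notLosing x y zero    false = trans (ℤ.+-identityʳ _) (ℤ.*-identityʳ y)
  ∑-fibre-rootWeight-notLosing x y (suc _) _     = refl

  -- Vertex 1 contributes x or y according to whether it has a losing child, that is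
  -- x + (y - x) * [it has none].
  weight-expand : ∀ x y (r : Vec (Fin (suc (suc m))) m) →
    let s = childStatus (Vec.map contract r) in
    weight x y (zero ∷ r) ≡ x * prodWith (rootWeight x y) r s
                          + (y - x) * prodWith (λ a b → rootWeight x y a b * notLosingChildOf (suc zero) a b) r s
  weight-expand x y r = begin
    rootWeight x y zero w₁ * P
      ≡⟨ split w₁ ⟩
    x * P + (y - x) * (P * (if w₁ then + 0 else + 1))
      ≡⟨ cong (λ t → x * P + (y - x) * (P * t)) (noLosingChild-indicator (suc zero) r s) ⟩
    x * P + (y - x) * (P * prodWith (notLosingChildOf (suc zero)) r s)
      ≡⟨ cong (λ t → x * P + (y - x) * t) (prodWith-* (rootWeight x y) (notLosingChildOf (suc zero)) r s) ⟩
    x * P + (y - x) * prodWith (λ a b → rootWeight x y a b * notLosingChildOf (suc zero) a b) r s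
      ∎
    where
    open ≡-Reasoning
    s = childStatus (Vec.map contract r)
    w₁ = hasLosingChild (suc zero) r s
    P = prodWith (rootWeight x y) r s
    split : ∀ b → rootWeight x y zero b * P ≡ x * P + (y - x) * (P * (if b then + 0 else + 1))
    split true  = wins-case x y P
      where
      wins-case : ∀ x y P → x * P ≡ x * P + (y - x) * (P * + 0)
      wins-case = solve-∀
    split false = loses-case x y P
      where
      loses-case : ∀ x y P → y * P ≡ x * P + (y - x) * (P * + 1)
      loses-case = solve-∀

  ∑-expansions-weight : ∀ x y (q : ParentMap m) →
    ∑[ r ∈ expansions q ] weight x y (zero ∷ r)
      ≡ x * weight (x + + 1) (y + + 1) q + (y - x) * weight (x + + 1) y q
  ∑-expansions-weight {m} x y q = begin
    ∑[ r ∈ expansions q ] weight x y (zero ∷ r)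
      ≡⟨ ∑-cong (expansions q) (λ {r} r∈ → trans (weight-expand x y r)
                                                 (cong (split-weight r) (contract-∈-expansions q r∈))) ⟩
    ∑[ r ∈ expansions q ] split-weight r q
      ≡⟨ ∑-distrib-+ (expansions q) _ _ ⟩
    ∑[ r ∈ expansions q ] x * prodWith W r s + ∑[ r ∈ expansions q ] (y - x) * prodWith W′ r s
      ≡⟨ cong₂ _+_ (∑-distribˡ x (expansions q) _) (∑-distribˡ (y - x) (expansions q) _) ⟩
    x * (∑[ r ∈ expansions q ] prodWith W r s) + (y - x) * (∑[ r ∈ expansions q ] prodWith W′ r s)
      ≡⟨ cong₂ (λ u v → x * u + (y - x) * v) (∑-expansions (∑-fibre-rootWeight x y) q s)
                                             (∑-expansions (∑-fibre-rootWeight-notLosing x y) q s) ⟩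
    x * weight (x + + 1) (y + + 1) q + (y - x) * weight (x + + 1) y q
      ∎
    where
    open ≡-Reasoning
    s = childStatus q
    W = rootWeight x y
    W′ = λ a b → rootWeight x y a b * notLosingChildOf (suc zero) a b
    split-weight : Vec (Fin (suc (suc m))) m → ParentMap m → ℤ
    split-weight r q′ = x * prodWith W r (childStatus q′) + (y - x) * prodWith W′ r (childStatus q′)

  weightSum-suc : ∀ m x y →
    weightSum (suc m) x y ≡ x * weightSum m (x + + 1) (y + + 1) + (y - x) * weightSum m (x + + 1) y
  weightSum-suc m x y = begin
    weightSum (suc m) x y
      ≡⟨ ∑-concatMap (λ q → map (zero ∷_) (expansions q)) (increasingTrees m) (weight x y) ⟩
    ∑[ q ∈ increasingTrees m ] ∑[ p ∈ map (zero ∷_) (expansions q) ] weight x y p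
      ≡⟨ ∑-cong (increasingTrees m) (λ {q} _ → trans (∑-map (zero ∷_) (expansions q) (weight x y))
                                                      (∑-expansions-weight x y q)) ⟩
    ∑[ q ∈ increasingTrees m ] (x * weight (x + + 1) (y + + 1) q + (y - x) * weight (x + + 1) y q)
      ≡⟨ ∑-distrib-+ (increasingTrees m) _ _ ⟩
    ∑[ q ∈ increasingTrees m ] x * weight (x + + 1) (y + + 1) q
      + ∑[ q ∈ increasingTrees m ] (y - x) * weight (x + + 1) y q
      ≡⟨ cong₂ _+_ (∑-distribˡ x (increasingTrees m) _) (∑-distribˡ (y - x) (increasingTrees m) _) ⟩
    x * weightSum m (x + + 1) (y + + 1) + (y - x) * weightSum m (x + + 1) y
      ∎
    where open ≡-Reasoning

  weightSum≡treePoly : ∀ m x y → weightSum m x y ≡ treePoly m x y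
  weightSum≡treePoly zero    x y = refl
  weightSum≡treePoly (suc m) x y = trans (weightSum-suc m x y)
    (cong₂ (λ u v → x * u + (y - x) * v) (weightSum≡treePoly m (x + + 1) (y + + 1))
                                         (weightSum≡treePoly m (x + + 1) y))

  secondPlayerTrees : ∀ m → List (ParentMap m)
  secondPlayerTrees m = filter (λ p → rootStatus p Bool.≟ false) (increasingTrees m)

  secondPlayerTrees-unique : ∀ m → Unique (secondPlayerTrees m)
  secondPlayerTrees-unique m = Unique.filter⁺ _ (increasingTrees-unique m)

  ∈-secondPlayerTrees : ∀ (p : ParentMap m) →
                        p ∈ secondPlayerTrees m ⇔ (IsIncreasing p × SecondPlayerWins p)
  ∈-secondPlayerTrees {m} p = mk⇔ to from
    where
    to : p ∈ secondPlayerTrees m → IsIncreasing p × SecondPlayerWins p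
    to p∈ with ∈-filter⁻ (λ p → rootStatus p Bool.≟ false) {xs = increasingTrees m} p∈
    ... | p∈trees , root-loses = inc , lost (rootStatus-correct p inc) root-loses
      where
      inc = Equivalence.to (∈-increasingTrees p) p∈trees
      lost : ∀ {b} → Outcome p zero b → b ≡ false → Lose p zero
      lost (loses l) refl = l
    from : IsIncreasing p × SecondPlayerWins p → p ∈ secondPlayerTrees m
    from (inc , l) =
      ∈-filter⁺ _ (Equivalence.from (∈-increasingTrees p) inc) (outcome-lose (rootStatus-correct p inc) l)

  length-secondPlayerTrees : ∀ m → + length (secondPlayerTrees m) ≡ weightSum m (+ 1) (+ 0)
  length-secondPlayerTrees m = trans (length-filter-false rootStatus (increasingTrees m))
                                     (sym (∑-cong (increasingTrees m) (λ {p} _ → weight-one-zero p)))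

open RisingFactorials using (a≡treePoly)
open GameTrees using (secondPlayerTrees; secondPlayerTrees-unique; ∈-secondPlayerTrees;
                      length-secondPlayerTrees; weightSum≡treePoly)

mainTheorem1 : (m : ℕ) →
    Σ ℕ (λ N → HasCount (λ (p : ParentMap m) → IsIncreasing p × SecondPlayerWins p) N
                 × a (suc m) ≡ + N)
    × (+ 0 ≤ a (suc m))
mainTheorem1 m = (length trees , (trees , secondPlayerTrees-unique m , ∈-secondPlayerTrees , refl) , a≡count)
               , subst (+ 0 ≤_) (sym a≡count) (+≤+ z≤n)
  where
  trees = secondPlayerTrees m
  a≡count : a (suc m) ≡ + length trees
  a≡count = trans (a≡treePoly m)
                  (trans (sym (weightSum≡treePoly m (+ 1) (+ 0))) (sym (length-secondPlayerTrees m)))
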